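{- Let $\mathcal D$ be the subspace of $\mathcal{OG}$ spanned by the ordered graphs of the form $G(h)$ for all Hessenberg functions $h\colon[n]\to[n]$ and all $n\ge0$. Then $\mathcal D$ is closed under the multiplication and comultiplication maps of $\mathcal{OG}$, so that it is a graded-connected Hopf subalgebra.
   Context: $\mathcal{OG}$ is the $\mathbb C(q)$-vector space with basis the isomorphism classes of finite ordered graphs $G=(V,E,<)$ (isomorphisms preserve edges and order). Multiplication: $\nabla_r(G_1\otimes\cdots\otimes G_r)$ is the lexicographic union (disjoint union of vertex and edge sets, with the orders of the $G_i$ kept and every vertex of $G_i$ before every vertex of $G_j$ when $i<j$). Comultiplication: $\Delta_r(G)=\sum_{\kappa\colon V\to[r]}q^{\#\text{ascents of }\kappa}G|_{\kappa^{ -1}(1)}\otimes\cdots\otimes G|_{\kappa^{ -1}(r)}$, sum over all functions, ascents being edges $\{u,v\}$ with $u<v$, $\kappa(u)<\kappa(v)$, and $G|_U$ the induced ordered subgraph. Grading by number of vertices; $\mathcal{OG}$ is a graded-connected Hopf algebra. A Hessenberg function is $h\colon[n]\to[n]$ with $i\le h(i)$ and $h(i)\le h(i+1)$; $G(h)$ is the ordered graph on $[n]$ with edge $\{i,j\}$ iff $i<j\le h(i)$. -}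

module Defs where

open import Data.Nat as ℕ using (ℕ; zero; suc)
open import Data.Fin using (Fin; zero; suc; toℕ; splitAt; _<_; _≤_)
open import Data.Fin.Properties using (_≟_; _≤?_; _<?_; <-irrefl)
open import Data.Bool using (Bool; true; false; _∧_; _∨_)
open import Data.Bool.Properties using (∨-comm)
open import Data.Sum using (_⊎_; inj₁; inj₂)
open import Data.Product using (Σ; _×_; _,_; ∃)
open import Data.Empty using (⊥-elim)
open import Relation.Nullary using (does; yes; no)
open import Relation.Binary.PropositionalEquality using (_≡_; refl)

-- Every finite ordered graph (V,E,<) is
-- order-isomorphic to one whose vertex set is Fin n with its natural
-- order, so we take vertex sets Fin n; edges are given by a symmetric,
-- irreflexive Boolean adjacency relation.

record OGraph : Set where
  field
    size   : ℕ
    adj    : Fin size → Fin size → Bool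
    sym    : ∀ i j → adj i j ≡ adj j i
    irrefl : ∀ i → adj i i ≡ false
open OGraph public

StrictlyIncreasing : ∀ {m n} → (Fin m → Fin n) → Set
StrictlyIncreasing f = ∀ i j → i < j → f i < f j

record OrdIso (G H : OGraph) : Set where
  field
    map        : Fin (size G) → Fin (size H)
    increasing : StrictlyIncreasing map
    surjective : ∀ y → ∃ λ x → map x ≡ y
    preserves  : ∀ i j → adj H (map i) (map j) ≡ adj G i j

record InducedIso (G : OGraph) (P : Fin (size G) → Bool) (H : OGraph) : Set where
  field
    embed      : Fin (size H) → Fin (size G)
    increasing : StrictlyIncreasing embed
    inSubset   : ∀ j → P (embed j) ≡ true
    onto       : ∀ v → P v ≡ true → ∃ λ j → embed j ≡ v
    preserves  : ∀ i j → adj G (embed i) (embed j) ≡ adj H i j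

-- Lexicographic union (the multiplication of OG).

emptyG : OGraph
emptyG = record { size = 0 ; adj = λ () ; sym = λ () ; irrefl = λ () }

private
  sumAdj : ∀ {m n} → (Fin m → Fin m → Bool) → (Fin n → Fin n → Bool)
         → Fin m ⊎ Fin n → Fin m ⊎ Fin n → Bool
  sumAdj a b (inj₁ x) (inj₁ y) = a x y
  sumAdj a b (inj₂ x) (inj₂ y) = b x y
  sumAdj a b (inj₁ x) (inj₂ y) = false
  sumAdj a b (inj₂ x) (inj₁ y) = false

  sumSym : ∀ {m n} (a : Fin m → Fin m → Bool) (b : Fin n → Fin n → Bool)
         → (∀ i j → a i j ≡ a j i) → (∀ i j → b i j ≡ b j i)
         → ∀ x y → sumAdj a b x y ≡ sumAdj a b y x
  sumSym a b sa sb (inj₁ x) (inj₁ y) = sa x y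
  sumSym a b sa sb (inj₂ x) (inj₂ y) = sb x y
  sumSym a b sa sb (inj₁ x) (inj₂ y) = refl
  sumSym a b sa sb (inj₂ x) (inj₁ y) = refl

  sumIrr : ∀ {m n} (a : Fin m → Fin m → Bool) (b : Fin n → Fin n → Bool)
         → (∀ i → a i i ≡ false) → (∀ i → b i i ≡ false)
         → ∀ x → sumAdj a b x x ≡ false
  sumIrr a b ia ib (inj₁ x) = ia x
  sumIrr a b ia ib (inj₂ x) = ib x

_⊕_ : OGraph → OGraph → OGraph
G ⊕ H = record
  { size   = size G ℕ.+ size H
  ; adj    = λ i j → sumAdj (adj G) (adj H) (splitAt (size G) i) (splitAt (size G) j)
  ; sym    = λ i j → sumSym (adj G) (adj H) (sym G) (sym H) (splitAt (size G) i) (splitAt (size G) j)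
  ; irrefl = λ i → sumIrr (adj G) (adj H) (irrefl G) (irrefl H) (splitAt (size G) i)
  }

lexUnion : (r : ℕ) → (Fin r → OGraph) → OGraph
lexUnion zero    gs = emptyG
lexUnion (suc r) gs = gs zero ⊕ lexUnion r (λ i → gs (suc i))

-- Hessenberg functions h : [n] → [n] (here [n] = Fin n, 0-indexed):
-- i ≤ h(i) and h(i) ≤ h(i+1).

record Hessenberg (n : ℕ) : Set where
  field
    fun       : Fin n → Fin n
    extensive : ∀ i → i ≤ fun i
    monotone  : ∀ (i j : Fin n) → toℕ j ≡ suc (toℕ i) → fun i ≤ fun j
open Hessenberg public

HessFun : Set
HessFun = Σ ℕ Hessenberg

private
  hessAdj : ∀ {n} → Hessenberg n → Fin n → Fin n → Bool
  hessAdj h i j = (does (i <? j) ∧ does (j ≤? fun h i)) ∨ (does (j <? i) ∧ does (i ≤? fun h j))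

  hessIrr : ∀ {n} (h : Hessenberg n) i → hessAdj h i i ≡ false
  ltb-irr : ∀ n → (n ℕ.<ᵇ n) ≡ false
  ltb-irr zero    = refl
  ltb-irr (suc n) = ltb-irr n

  hessIrr h i rewrite ltb-irr (toℕ i) = refl

hessGraph : HessFun → OGraph
hessGraph (n , h) = record
  { size   = n
  ; adj    = hessAdj h
  ; sym    = λ i j → ∨-comm (does (i <? j) ∧ does (j ≤? fun h i)) (does (j <? i) ∧ does (i ≤? fun h j))
  ; irrefl = hessIrr h
  }

fiber : ∀ {n r} → (Fin n → Fin r) → Fin r → Fin n → Bool
fiber κ c v = does (κ v ≟ c)

{-# OPTIONS --safe #-}
-- An ordered graph on Fin n is the graph of a Hessenberg function exactly when its
-- edges are closed under shrinking: if {a,d} is an edge and a ≤ b < c ≤ d, then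
-- {b,c} is an edge.  Given this, h(i) is the largest neighbour of i above i (or i
-- itself), and the neighbours of i above i are precisely i+1, …, h(i).  The property
-- survives lexicographic unions, which add no edges between the blocks, and
-- restriction to an induced subgraph, which keeps the relative order of the vertices.
module Submission where

open import Defs
open import Data.Nat as ℕ using (ℕ; zero; suc; z≤n; s≤s; _+_; _∸_)
import Data.Nat.Properties as ℕ
open import Data.Fin using (Fin; zero; suc; toℕ; _≤_; _<_; _↑ˡ_; _↑ʳ_; splitAt; fromℕ<)
open import Data.Fin.Properties
  using (_≤?_; _<?_; <-cmp; any?; toℕ-injective; toℕ-fromℕ<; toℕ<n; toℕ-↑ˡ; toℕ-↑ʳ;
         splitAt-↑ˡ; splitAt-↑ʳ; splitAt⁻¹-↑ˡ; splitAt⁻¹-↑ʳ)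
open import Data.Bool using (Bool; true; false; _∨_)
open import Data.Bool.Properties using (_≟_; ∨-identityʳ; ∨-zeroʳ; ¬-not)
open import Data.Sum using (inj₁; inj₂)
open import Data.Product using (Σ; _×_; _,_; ∃; proj₁; proj₂)
open import Data.Empty using (⊥; ⊥-elim)
open import Function using (_∘_)
open import Relation.Binary using (tri<; tri≈; tri>)
open import Relation.Nullary using (Dec; does; yes; no)
open import Relation.Nullary.Decidable using (dec-true; dec-false)
open import Relation.Binary.PropositionalEquality
  using (_≡_; _≢_; refl; cong; trans; subst; subst₂) renaming (sym to ≡-sym)

IntervalClosed : OGraph → Set
IntervalClosed G = ∀ a b c d → a ≤ b → b < c → c ≤ d →
  adj G a d ≡ true → adj G b c ≡ true

true≢false : true ≢ false
true≢false ()

does≡true⇒ : ∀ {a} {A : Set a} (a? : Dec A) → does a? ≡ true → A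
does≡true⇒ (yes a) _ = a

∃-greatest : ∀ {n} (P : Fin n → Bool) {w} → P w ≡ true →
  Σ (Fin n) λ m → P m ≡ true × (∀ j → P j ≡ true → j ≤ m)
∃-greatest {suc n} P {w} Pw with any? (λ j → P (suc j) ≟ true)
... | yes (j , Psj) with m , Pm , greatest ← ∃-greatest (P ∘ suc) Psj
  = suc m , Pm , λ { zero _ → z≤n ; (suc k) Pk → s≤s (greatest k Pk) }
... | no ¬Psuc with w
...   | zero  = zero , Pw , λ { zero _ → z≤n ; (suc k) Pk → ⊥-elim (¬Psuc (k , Pk)) }
...   | suc w = ⊥-elim (¬Psuc (w , Pw))

hessGraph-adj-< : ∀ {n} (h : Hessenberg n) {i j} → i < j →
  adj (hessGraph (n , h)) i j ≡ does (j ≤? fun h i)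
hessGraph-adj-< h {i} {j} i<j
  rewrite dec-true (i <? j) i<j | dec-false (j <? i) (ℕ.<-asym i<j) = ∨-identityʳ _

fun-mono : ∀ {n} (h : Hessenberg n) {i j} → i ≤ j → fun h i ≤ fun h j
fun-mono h {i} {j} i≤j = go (toℕ j ∸ toℕ i) j (≡-sym (ℕ.m∸n+n≡m i≤j))
  where
  go : ∀ k j → toℕ j ≡ k + toℕ i → fun h i ≤ fun h j
  go zero    j j≡i rewrite toℕ-injective j≡i = ℕ.≤-refl
  go (suc k) j j≡1+k+i = ℕ.≤-trans (go k j′ j′≡k+i) (monotone h j′ j j≡1+j′)
    where
    k+i<n = ℕ.<-trans (ℕ.≤-reflexive (≡-sym j≡1+k+i)) (toℕ<n j)
    j′ = fromℕ< k+i<n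
    j′≡k+i = toℕ-fromℕ< k+i<n
    j≡1+j′ = trans j≡1+k+i (cong suc (≡-sym j′≡k+i))

hessGraph-intervalClosed : (h : HessFun) → IntervalClosed (hessGraph h)
hessGraph-intervalClosed (n , h) a b c d a≤b b<c c≤d ad =
  trans (hessGraph-adj-< h b<c) (dec-true (c ≤? fun h b) c≤hb)
  where
  a<d = ℕ.≤-<-trans a≤b (ℕ.<-≤-trans b<c c≤d)
  d≤ha : d ≤ fun h a
  d≤ha = does≡true⇒ (d ≤? fun h a) (trans (≡-sym (hessGraph-adj-< h a<d)) ad)
  c≤hb = ℕ.≤-trans c≤d (ℕ.≤-trans d≤ha (fun-mono h a≤b))

module HessenbergOf (G : OGraph) (closed : IntervalClosed G) where

  reaches : Fin (size G) → Fin (size G) → Bool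
  reaches i j = does (j ≤? i) ∨ adj G i j

  reaches-refl : ∀ i → reaches i i ≡ true
  reaches-refl i rewrite dec-true (i ≤? i) (ℕ.≤-refl {toℕ i}) = refl

  reaches-< : ∀ {i j} → i < j → reaches i j ≡ adj G i j
  reaches-< {i} {j} i<j rewrite dec-false (j ≤? i) (ℕ.<⇒≱ i<j) = refl

  adj⇒reaches : ∀ {i j} → adj G i j ≡ true → reaches i j ≡ true
  adj⇒reaches {i} {j} ij rewrite ij = ∨-zeroʳ _

  private
    greatest-reached : ∀ i →
      Σ (Fin (size G)) λ m → reaches i m ≡ true × (∀ j → reaches i j ≡ true → j ≤ m)
    greatest-reached i = ∃-greatest (reaches i) (reaches-refl i)

  h : Fin (size G) → Fin (size G)
  h i = proj₁ (greatest-reached i)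

  reaches-h : ∀ i → reaches i (h i) ≡ true
  reaches-h i = proj₁ (proj₂ (greatest-reached i))

  reaches⇒≤h : ∀ {i j} → reaches i j ≡ true → j ≤ h i
  reaches⇒≤h {i} {j} = proj₂ (proj₂ (greatest-reached i)) j

  h-extensive : ∀ i → i ≤ h i
  h-extensive i = reaches⇒≤h (reaches-refl i)

  adj-h : ∀ {i} → i < h i → adj G i (h i) ≡ true
  adj-h {i} i<hi = trans (≡-sym (reaches-< i<hi)) (reaches-h i)

  h-mono : ∀ {i j} → i ≤ j → h i ≤ h j
  h-mono {i} {j} i≤j with h i ≤? j
  ... | yes hi≤j = ℕ.≤-trans hi≤j (h-extensive j)
  ... | no  hi≰j = reaches⇒≤h (adj⇒reaches
          (closed i j (h i) (h i) i≤j j<hi ℕ.≤-refl (adj-h (ℕ.≤-<-trans i≤j j<hi))))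
    where j<hi = ℕ.≰⇒> hi≰j

  hessenberg : Hessenberg (size G)
  hessenberg = record
    { fun       = h
    ; extensive = h-extensive
    ; monotone  = λ i j j≡1+i → h-mono (subst (toℕ i ℕ.≤_) (≡-sym j≡1+i) (ℕ.n≤1+n (toℕ i)))
    }

  ≤h⇔adj : ∀ {i j} → i < j → does (j ≤? h i) ≡ adj G i j
  ≤h⇔adj {i} {j} i<j with j ≤? h i
  ... | yes j≤hi = trans (dec-true (j ≤? h i) j≤hi)
          (≡-sym (closed i i j (h i) ℕ.≤-refl i<j j≤hi (adj-h (ℕ.<-≤-trans i<j j≤hi))))
  ... | no  j≰hi = trans (dec-false (j ≤? h i) j≰hi)
          (≡-sym (¬-not (j≰hi ∘ reaches⇒≤h ∘ adj⇒reaches)))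

  graph : OGraph
  graph = hessGraph (size G , hessenberg)

  graph-adj-< : ∀ {i j} → i < j → adj graph i j ≡ adj G i j
  graph-adj-< i<j = trans (hessGraph-adj-< hessenberg i<j) (≤h⇔adj i<j)

  graph-adj : ∀ i j → adj graph i j ≡ adj G i j
  graph-adj i j with <-cmp i j
  ... | tri< i<j _ _  = graph-adj-< i<j
  ... | tri≈ _ refl _ = trans (irrefl graph i) (≡-sym (irrefl G i))
  ... | tri> _ _ j<i  = trans (sym graph i j) (trans (graph-adj-< j<i) (sym G j i))

intervalClosed⇒OrdIso : ∀ G → IntervalClosed G → Σ HessFun λ h → OrdIso G (hessGraph h)
intervalClosed⇒OrdIso G closed = (size G , hessenberg) , record
  { map        = λ i → i
  ; increasing = λ _ _ i<j → i<j
  ; surjective = λ j → j , refl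
  ; preserves  = graph-adj
  }
  where open HessenbergOf G closed

data Block (m n : ℕ) : Fin (m + n) → Set where
  left  : ∀ x → Block m n (x ↑ˡ n)
  right : ∀ y → Block m n (m ↑ʳ y)

block : ∀ m n i → Block m n i
block m n i with splitAt m i in eq
... | inj₁ x = subst (Block m n) (splitAt⁻¹-↑ˡ eq) (left x)
... | inj₂ y = subst (Block m n) (splitAt⁻¹-↑ʳ eq) (right y)

module _ {m n : ℕ} where

  ↑ˡ-cancel-≤ : ∀ {x y : Fin m} → x ↑ˡ n ≤ y ↑ˡ n → x ≤ y
  ↑ˡ-cancel-≤ {x} {y} = subst₂ ℕ._≤_ (toℕ-↑ˡ x n) (toℕ-↑ˡ y n)

  ↑ˡ-cancel-< : ∀ {x y : Fin m} → x ↑ˡ n < y ↑ˡ n → x < y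
  ↑ˡ-cancel-< {x} {y} = subst₂ ℕ._<_ (toℕ-↑ˡ x n) (toℕ-↑ˡ y n)

  ↑ʳ-cancel-≤ : ∀ {x y : Fin n} → m ↑ʳ x ≤ m ↑ʳ y → x ≤ y
  ↑ʳ-cancel-≤ {x} {y} = ℕ.+-cancelˡ-≤ m _ _ ∘ subst₂ ℕ._≤_ (toℕ-↑ʳ m x) (toℕ-↑ʳ m y)

  ↑ʳ-cancel-< : ∀ {x y : Fin n} → m ↑ʳ x < m ↑ʳ y → x < y
  ↑ʳ-cancel-< {x} {y} = ℕ.+-cancelˡ-< m _ _ ∘ subst₂ ℕ._<_ (toℕ-↑ʳ m x) (toℕ-↑ʳ m y)

  ↑ˡ<↑ʳ : ∀ (x : Fin m) (y : Fin n) → x ↑ˡ n < m ↑ʳ y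
  ↑ˡ<↑ʳ x y = subst₂ ℕ._<_ (≡-sym (toℕ-↑ˡ x n)) (≡-sym (toℕ-↑ʳ m y))
    (ℕ.<-≤-trans (toℕ<n x) (ℕ.m≤m+n m (toℕ y)))

  ↑ʳ≰↑ˡ : ∀ (y : Fin n) (x : Fin m) → m ↑ʳ y ≤ x ↑ˡ n → ⊥
  ↑ʳ≰↑ˡ y x = ℕ.<⇒≱ (↑ˡ<↑ʳ x y)

module _ (G H : OGraph) where
  private
    m = size G
    n = size H

  ⊕-adj-left : ∀ x y → adj (G ⊕ H) (x ↑ˡ n) (y ↑ˡ n) ≡ adj G x y
  ⊕-adj-left x y rewrite splitAt-↑ˡ m x n | splitAt-↑ˡ m y n = refl

  ⊕-adj-right : ∀ x y → adj (G ⊕ H) (m ↑ʳ x) (m ↑ʳ y) ≡ adj H x y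
  ⊕-adj-right x y rewrite splitAt-↑ʳ m n x | splitAt-↑ʳ m n y = refl

  ⊕-adj-left-right : ∀ x y → adj (G ⊕ H) (x ↑ˡ n) (m ↑ʳ y) ≡ false
  ⊕-adj-left-right x y rewrite splitAt-↑ˡ m x n | splitAt-↑ʳ m n y = refl

  ⊕-adj-right-left : ∀ x y → adj (G ⊕ H) (m ↑ʳ x) (y ↑ˡ n) ≡ false
  ⊕-adj-right-left x y rewrite splitAt-↑ʳ m n x | splitAt-↑ˡ m y n = refl

  ⊕-intervalClosed : IntervalClosed G → IntervalClosed H → IntervalClosed (G ⊕ H)
  ⊕-intervalClosed closedG closedH a b c d a≤b b<c c≤d ad
    with block m n a | block m n b | block m n c | block m n d
  ... | left a | left b | left c | left d =
    trans (⊕-adj-left b c) (closedG a b c d (↑ˡ-cancel-≤ a≤b) (↑ˡ-cancel-< b<c) (↑ˡ-cancel-≤ c≤d)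
      (trans (≡-sym (⊕-adj-left a d)) ad))
  ... | right a | right b | right c | right d =
    trans (⊕-adj-right b c) (closedH a b c d (↑ʳ-cancel-≤ a≤b) (↑ʳ-cancel-< b<c) (↑ʳ-cancel-≤ c≤d)
      (trans (≡-sym (⊕-adj-right a d)) ad))
  ... | left a  | _ | _ | right d = ⊥-elim (true≢false (trans (≡-sym ad) (⊕-adj-left-right a d)))
  ... | right a | _ | _ | left d  = ⊥-elim (true≢false (trans (≡-sym ad) (⊕-adj-right-left a d)))
  ... | left _  | right b | _ | left d = ⊥-elim (↑ʳ≰↑ˡ b d (ℕ.≤-trans (ℕ.<⇒≤ b<c) c≤d))
  ... | left _  | left _ | right c | left d = ⊥-elim (↑ʳ≰↑ˡ c d c≤d)
  ... | right a | left b | _ | right _ = ⊥-elim (↑ʳ≰↑ˡ a b a≤b)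
  ... | right _ | right b | left c | right _ = ⊥-elim (↑ʳ≰↑ˡ b c (ℕ.<⇒≤ b<c))

lexUnion-intervalClosed : ∀ r (gs : Fin r → OGraph) → (∀ i → IntervalClosed (gs i)) →
  IntervalClosed (lexUnion r gs)
lexUnion-intervalClosed zero    gs closed ()
lexUnion-intervalClosed (suc r) gs closed = ⊕-intervalClosed (gs zero) (lexUnion r (gs ∘ suc))
  (closed zero) (lexUnion-intervalClosed r (gs ∘ suc) (closed ∘ suc))

record Enumeration {n} (P : Fin n → Bool) : Set where
  field
    count      : ℕ
    embed      : Fin count → Fin n
    increasing : StrictlyIncreasing embed
    inSubset   : ∀ j → P (embed j) ≡ true
    onto       : ∀ v → P v ≡ true → ∃ λ j → embed j ≡ v

module _ {n} {P : Fin (suc n) → Bool} (E : Enumeration (P ∘ suc)) where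
  open Enumeration E

  enumeration-cons : P zero ≡ true → Enumeration P
  enumeration-cons P0 = record
    { count = suc count ; embed = embed′ ; increasing = increasing′
    ; inSubset = inSubset′ ; onto = onto′ }
    where
    embed′ : Fin (suc count) → Fin (suc n)
    embed′ zero    = zero
    embed′ (suc j) = suc (embed j)
    increasing′ : StrictlyIncreasing embed′
    increasing′ zero    (suc j) _         = s≤s z≤n
    increasing′ (suc i) (suc j) (s≤s i<j) = s≤s (increasing i j i<j)
    inSubset′ : ∀ j → P (embed′ j) ≡ true
    inSubset′ zero    = P0
    inSubset′ (suc j) = inSubset j
    onto′ : ∀ v → P v ≡ true → ∃ λ j → embed′ j ≡ v
    onto′ zero    _  = zero , refl
    onto′ (suc v) Pv with j , refl ← onto v Pv = suc j , refl

  enumeration-skip : P zero ≡ false → Enumeration P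
  enumeration-skip ¬P0 = record
    { count = count ; embed = suc ∘ embed ; increasing = λ i j i<j → s≤s (increasing i j i<j)
    ; inSubset = inSubset ; onto = onto′ }
    where
    onto′ : ∀ v → P v ≡ true → ∃ λ j → suc (embed j) ≡ v
    onto′ zero    P0 = ⊥-elim (true≢false (trans (≡-sym P0) ¬P0))
    onto′ (suc v) Pv with j , refl ← onto v Pv = j , refl

enumerate : ∀ {n} (P : Fin n → Bool) → Enumeration P
enumerate {zero}  P = record
  { count = 0 ; embed = λ () ; increasing = λ () ; inSubset = λ () ; onto = λ () }
enumerate {suc n} P with P zero in P0
... | true  = enumeration-cons (enumerate (P ∘ suc)) P0
... | false = enumeration-skip (enumerate (P ∘ suc)) P0

restrict : (G : OGraph) {m : ℕ} → (Fin m → Fin (size G)) → OGraph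
restrict G {m} e = record
  { size   = m
  ; adj    = λ i j → adj G (e i) (e j)
  ; sym    = λ i j → sym G (e i) (e j)
  ; irrefl = λ i → irrefl G (e i)
  }

strictlyIncreasing-mono-≤ : ∀ {m n} {e : Fin m → Fin n} → StrictlyIncreasing e →
  ∀ {i j} → i ≤ j → e i ≤ e j
strictlyIncreasing-mono-≤ increasing {i} {j} i≤j with ℕ.m≤n⇒m<n∨m≡n i≤j
... | inj₁ i<j = ℕ.<⇒≤ (increasing i j i<j)
... | inj₂ i≡j rewrite toℕ-injective i≡j = ℕ.≤-refl

restrict-intervalClosed : ∀ G {m} {e : Fin m → Fin (size G)} → StrictlyIncreasing e →
  IntervalClosed G → IntervalClosed (restrict G e)
restrict-intervalClosed G {e = e} increasing closed a b c d a≤b b<c c≤d =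
  closed (e a) (e b) (e c) (e d)
    (strictlyIncreasing-mono-≤ increasing a≤b) (increasing b c b<c)
    (strictlyIncreasing-mono-≤ increasing c≤d)

intervalClosed⇒InducedIso : ∀ G → IntervalClosed G → (P : Fin (size G) → Bool) →
  Σ HessFun λ h → InducedIso G P (hessGraph h)
intervalClosed⇒InducedIso G closed P = (count , hessenberg) , record
  { embed      = embed
  ; increasing = increasing
  ; inSubset   = inSubset
  ; onto       = onto
  ; preserves  = λ i j → ≡-sym (graph-adj i j)
  }
  where
  open Enumeration (enumerate P)
  open HessenbergOf (restrict G embed) (restrict-intervalClosed G increasing closed)

mainTheorem5 :
    -- closure under ∇_r for every r : a lexicographic union of Hessenberg graphs is a Hessenberg graph
    ((r : ℕ) (hs : Fin r → HessFun) →
        Σ HessFun (λ h → OrdIso (lexUnion r (λ i → hessGraph (hs i))) (hessGraph h)))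
    ×
    -- closure under Δ_r for every r : every tensor factor G(h)|κ⁻¹(c) of every term is a Hessenberg graph
    ((h : HessFun) (r : ℕ) (κ : Fin (Σ.proj₁ h) → Fin r) (c : Fin r) →
        Σ HessFun (λ h′ → InducedIso (hessGraph h) (fiber κ c) (hessGraph h′)))
mainTheorem5 =
    (λ r hs → intervalClosed⇒OrdIso (lexUnion r (hessGraph ∘ hs))
                (lexUnion-intervalClosed r (hessGraph ∘ hs) (hessGraph-intervalClosed ∘ hs)))
  , (λ h r κ c → intervalClosed⇒InducedIso (hessGraph h) (hessGraph-intervalClosed h) (fiber κ c))
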